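{- Let $n \ge k \ge 1$ with $n+k$ odd. Then $\det_{n\,k}(X) = \det_{(n-1)\,k}(L^{ - }(X))$ for all $X \in \mathrm{M}_{n\,k}(\mathbb F)$.
   Context: $\mathbb F$ is a field. For $n \ge k$ and $X=(x_{i\,j})\in\mathrm{M}_{n\,k}(\mathbb F)$, the Cullis determinant is $\det_{n\,k}(X) = \sum_{\sigma} \operatorname{sgn}_{n\,k}(\sigma)\, x_{\sigma(1)\,1}\cdots x_{\sigma(k)\,k}$, the sum over all injections $\sigma\colon\{1,\ldots,k\}\to\{1,\ldots,n\}$, where, writing $\sigma(\{1,\dots,k\})=\{i_1<\cdots<i_k\}$, $\operatorname{sgn}_{n\,k}(\sigma)=\operatorname{sgn}(\pi_\sigma)(-1)^{\sum_{\alpha=1}^k(i_\alpha-\alpha)}$ with $\pi_\sigma$ the permutation of $\{i_1,\dots,i_k\}$ sending $i_\alpha\mapsto\sigma(\alpha)$. For $X\in\mathrm{M}_{n\,k}(\mathbb F)$, $L^{ - }(X)\in\mathrm{M}_{(n-1)\,k}(\mathbb F)$ is the matrix whose $r$-th row, $1\le r\le n-1$, equals the $r$-th row of $X$ minus the $n$-th row of $X$. -}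

module Defs where

open import Level using (Level; _⊔_) renaming (suc to lsuc)
open import Algebra.Bundles using (CommutativeRing)
open import Data.Nat as ℕ using (ℕ; zero; suc; _∸_; _<ᵇ_) renaming (_+_ to _+ℕ_)
open import Data.Fin as Fin using (Fin; toℕ; inject₁; fromℕ)
open import Data.Fin.Properties using () renaming (_≟_ to _≟ᶠ_)
open import Data.List as List using (List; []; _∷_; concatMap; allFin; foldr)
open import Data.Vec as Vec using (Vec; []; _∷_; lookup)
open import Data.Bool using (Bool; true; false; _∧_; not; if_then_else_)
open import Data.Product using (Σ-syntax; _×_)
open import Relation.Nullary using (¬_; does)

record Field (c ℓ : Level) : Set (lsuc (c ⊔ ℓ)) where
  field
    commutativeRing : CommutativeRing c ℓ
  open CommutativeRing commutativeRing public
  field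
    0≉1     : ¬ (0# ≈ 1#)
    inverse : ∀ x → ¬ (x ≈ 0#) → Σ[ y ∈ Carrier ] (x * y ≈ 1#)

-- Matrices with n rows and k columns: X i j = x_{i j} (indices 0-based).
Mat : ∀ {c} → Set c → ℕ → ℕ → Set c
Mat A n k = Fin n → Fin k → A

allVecs : (n k : ℕ) → List (Vec (Fin n) k)
allVecs n zero    = [] ∷ []
allVecs n (suc k) = concatMap (λ v → List.map (_∷ v) (allFin n)) (allVecs n k)

notIn : ∀ {n k} → Fin n → Vec (Fin n) k → Bool
notIn i []       = true
notIn i (j ∷ v)  = not (does (i ≟ᶠ j)) ∧ notIn i v

distinct : ∀ {n k} → Vec (Fin n) k → Bool
distinct []      = true
distinct (i ∷ v) = notIn i v ∧ distinct v

injections : (n k : ℕ) → List (Vec (Fin n) k)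
injections n k = keep (allVecs n k)
  where
    keep : List (Vec (Fin n) k) → List (Vec (Fin n) k)
    keep []       = []
    keep (v ∷ vs) = if distinct v then v ∷ keep vs else keep vs

-- Number of inversions of the sequence σ(1), …, σ(k): pairs α < β with σ(α) > σ(β).
-- Its parity is the sign of π_σ (the permutation i_α ↦ σ(α) of the image).
countGreater : ∀ {n k} → Fin n → Vec (Fin n) k → ℕ
countGreater i []      = 0
countGreater i (j ∷ v) = (if toℕ j <ᵇ toℕ i then 1 else 0) +ℕ countGreater i v

inversions : ∀ {n k} → Vec (Fin n) k → ℕ
inversions []      = 0
inversions (i ∷ v) = countGreater i v +ℕ inversions v

sumVals : ∀ {n k} → Vec (Fin n) k → ℕ
sumVals []      = 0
sumVals (i ∷ v) = toℕ i +ℕ sumVals v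

triangle : ℕ → ℕ
triangle zero    = 0
triangle (suc k) = k +ℕ triangle k

-- Σ_α (i_α - α) = Σ_α σ(α) - Σ_α α  (the same in 0-based or 1-based indexing)
shiftExp : ∀ {n k} → Vec (Fin n) k → ℕ
shiftExp {k = k} σ = sumVals σ ∸ triangle k

module _ {c ℓ} (F : Field c ℓ) where
  open Field F

  negOnePow : ℕ → Carrier
  negOnePow zero    = 1#
  negOnePow (suc m) = - negOnePow m

  sgnnk : ∀ {n k} → Vec (Fin n) k → Carrier
  sgnnk σ = negOnePow (inversions σ) * negOnePow (shiftExp σ)

  diagProd : ∀ {n k} → Mat Carrier n k → Vec (Fin n) k → Carrier
  diagProd {k = k} X σ = prod k (λ α → X (lookup σ α) α)
    where
      prod : (m : ℕ) → (Fin m → Carrier) → Carrier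
      prod zero    f = 1#
      prod (suc m) f = f Fin.zero * prod m (λ α → f (Fin.suc α))

  detCullis : (n k : ℕ) → Mat Carrier n k → Carrier
  detCullis n k X =
    foldr (λ σ acc → sgnnk σ * diagProd X σ + acc) 0# (injections n k)

  Lminus : ∀ {m k} → Mat Carrier (suc m) k → Mat Carrier m k
  Lminus {m} X r j = X (inject₁ r) j - X (fromℕ m) j

{-# OPTIONS --safe #-}
module Submission where

open import Defs
open import Algebra.Bundles using (Semiring; Ring)
import Algebra.Properties.CommutativeSemigroup as CommutativeSemigroupProperties
open import Data.Bool using (Bool; true; false; T; if_then_else_)
open import Data.Fin using (Fin; zero; suc; toℕ; inject₁; fromℕ; punchIn)
open import Data.Fin.Properties using (toℕ-inject₁)
open import Data.List as List using (List; []; _∷_; _++_; foldr; allFin; concatMap)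
open import Data.List.Properties using (map-tabulate)
open import Data.Nat as ℕ using (ℕ; zero; suc; _∸_; _≤_; parity)
import Data.Nat.Properties as ℕ
open import Data.Parity.Base using (0ℙ; 1ℙ; _⁻¹)
open import Data.Parity.Properties using (suc-homo-⁻¹)
open import Data.Vec as Vec using (Vec; []; _∷_)
open import Data.Vec.Functional as Vector using (Vector; removeAt; tail; init; last)
open import Function using (_∘_; id)
open import Relation.Binary.PropositionalEquality as ≡ using (_≡_)

-- Expanding along the first column, the Cullis determinant obeys Laplace's rule
--   det X = Σᵢ (-1)^i x_{i0} det(X without row i and column 0)      (rows counted from 0),
-- because the injection i ∷ (punchIn i ∘ w) has sign (-1)^i times the sign of w.
-- The minors of L⁻X are L⁻ of minors of X and (n-1) + (k-1) has the parity of n + k, so by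
-- induction, for X with n rows,
--   det X - det(L⁻X) = x_{n-1,0} · Σ_p (-1)^p det(Y without row p),
-- where Y is X without its first column. This alternating sum vanishes whenever Y has m rows
-- and j columns with m + j even: for j = 0 it is 1 - 1 + ⋯ with m terms; otherwise expanding
-- each det(Y without row p) once more gives a sum over ordered pairs (p, q) of distinct rows in
-- which exchanging the order of deletion flips the sign, so grouping by q leaves, for each q,
-- the same alternating sum for Y without row q and its first column, which vanishes by induction.

module IndexVectors where
  open import Data.Bool.Properties using (T-∧)
  open import Data.Fin using (punchOut)
  open import Data.Fin.Properties using (_≟_; punchIn-injective; punchInᵢ≢i; punchIn-punchOut; toℕ-injective)
  open import Data.Nat using (_+_; _<ᵇ_; _≡ᵇ_; _%_; z≤n; s≤s)
  open import Data.Nat.Tactic.RingSolver using (solve-∀)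
  open import Algebra.Properties.CommutativeSemigroup ℕ.+-commutativeSemigroup using (interchange)
  open import Data.Product using (∃-syntax; _,_; proj₁; proj₂)
  open import Function using (Equivalence)
  open import Relation.Nullary using (does; yes; no)
  open import Relation.Nullary.Decidable using (dec-true; dec-false)
  open import Relation.Binary.PropositionalEquality using (refl; cong; cong₂; sym; subst; module ≡-Reasoning)

  private variable
    n k : ℕ

  punchIn-inject₁ : (i : Fin (suc n)) (j : Fin n) → punchIn (inject₁ i) (inject₁ j) ≡ inject₁ (punchIn i j)
  punchIn-inject₁ zero    j       = refl
  punchIn-inject₁ (suc i) zero    = refl
  punchIn-inject₁ (suc i) (suc j) = cong suc (punchIn-inject₁ i j)

  punchIn-inject₁-fromℕ : (i : Fin (suc n)) → punchIn (inject₁ i) (fromℕ n) ≡ fromℕ (suc n)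
  punchIn-inject₁-fromℕ         zero    = refl
  punchIn-inject₁-fromℕ {suc n} (suc i) = cong suc (punchIn-inject₁-fromℕ i)

  -- punchOut without its proof of i ≢ j: the value at i = j is junk.
  punchOut′ : Fin (suc (suc n)) → Fin (suc (suc n)) → Fin (suc n)
  punchOut′         zero    zero    = zero
  punchOut′         zero    (suc j) = j
  punchOut′         (suc i) zero    = zero
  punchOut′ {zero}  (suc i) (suc j) = zero
  punchOut′ {suc n} (suc i) (suc j) = suc (punchOut′ i j)

  punchOut′-punchIn : (i : Fin (suc (suc n))) (j : Fin (suc n)) → punchOut′ i (punchIn i j) ≡ j
  punchOut′-punchIn         zero    j       = refl
  punchOut′-punchIn         (suc i) zero    = refl
  punchOut′-punchIn {suc n} (suc i) (suc j) = cong suc (punchOut′-punchIn i j)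

  -- Both sides enumerate the indices other than i and punchIn i j.
  punchIn-punchIn-punchOut′ : (i : Fin (suc (suc n))) (j : Fin (suc n)) (r : Fin n) →
    punchIn (punchIn i j) (punchIn (punchOut′ (punchIn i j) i) r) ≡ punchIn i (punchIn j r)
  punchIn-punchIn-punchOut′         zero    j       r       = refl
  punchIn-punchIn-punchOut′         (suc i) zero    r       = refl
  punchIn-punchIn-punchOut′ {suc n} (suc i) (suc j) zero    = refl
  punchIn-punchIn-punchOut′ {suc n} (suc i) (suc j) (suc r) = cong suc (punchIn-punchIn-punchOut′ i j r)

  toℕ-punchIn-<ᵇ : (i : Fin (suc n)) (j : Fin n) → (toℕ (punchIn i j) <ᵇ toℕ i) ≡ (toℕ j <ᵇ toℕ i)
  toℕ-punchIn-<ᵇ zero    j       = refl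
  toℕ-punchIn-<ᵇ (suc i) zero    = refl
  toℕ-punchIn-<ᵇ (suc i) (suc j) = toℕ-punchIn-<ᵇ i j

  toℕ-punchIn-<ᵇ-punchIn : (i : Fin (suc n)) (j l : Fin n) →
    (toℕ (punchIn i j) <ᵇ toℕ (punchIn i l)) ≡ (toℕ j <ᵇ toℕ l)
  toℕ-punchIn-<ᵇ-punchIn zero    j       l       = refl
  toℕ-punchIn-<ᵇ-punchIn (suc i) zero    zero    = refl
  toℕ-punchIn-<ᵇ-punchIn (suc i) zero    (suc l) = refl
  toℕ-punchIn-<ᵇ-punchIn (suc i) (suc j) zero    = refl
  toℕ-punchIn-<ᵇ-punchIn (suc i) (suc j) (suc l) = toℕ-punchIn-<ᵇ-punchIn i j l

  toℕ-punchIn : (i : Fin (suc n)) (j : Fin n) →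
    toℕ (punchIn i j) + (if toℕ j <ᵇ toℕ i then 1 else 0) ≡ suc (toℕ j)
  toℕ-punchIn zero    j       = ℕ.+-identityʳ _
  toℕ-punchIn (suc i) zero    = refl
  toℕ-punchIn (suc i) (suc j) = cong suc (toℕ-punchIn i j)

  does-punchIn-≟-punchIn : (i : Fin (suc n)) (j l : Fin n) → does (punchIn i j ≟ punchIn i l) ≡ does (j ≟ l)
  does-punchIn-≟-punchIn i j l with j ≟ l
  ... | yes refl = dec-true (punchIn i j ≟ punchIn i j) refl
  ... | no j≢l   = dec-false (punchIn i j ≟ punchIn i l) (j≢l ∘ punchIn-injective i j l)

  notIn-cons-self : (i : Fin n) (v : Vec (Fin n) k) → notIn i (i ∷ v) ≡ false
  notIn-cons-self i v rewrite dec-true (i ≟ i) refl = refl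

  notIn-cons-punchIn : (i : Fin (suc n)) (j : Fin n) (v : Vec (Fin (suc n)) k) → notIn i (punchIn i j ∷ v) ≡ notIn i v
  notIn-cons-punchIn i j v rewrite dec-false (i ≟ punchIn i j) (punchInᵢ≢i i j ∘ sym) = refl

  notIn-map-punchIn : (i : Fin (suc n)) (j : Fin n) (w : Vec (Fin n) k) →
    notIn (punchIn i j) (Vec.map (punchIn i) w) ≡ notIn j w
  notIn-map-punchIn i j []      = refl
  notIn-map-punchIn i j (l ∷ w) rewrite does-punchIn-≟-punchIn i j l | notIn-map-punchIn i j w = refl

  notIn-self-map-punchIn : (i : Fin (suc n)) (w : Vec (Fin n) k) → notIn i (Vec.map (punchIn i) w) ≡ true
  notIn-self-map-punchIn i []      = refl
  notIn-self-map-punchIn i (j ∷ w) rewrite notIn-cons-punchIn i j (Vec.map (punchIn i) w) = notIn-self-map-punchIn i w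

  distinct-map-punchIn : (i : Fin (suc n)) (w : Vec (Fin n) k) → distinct (Vec.map (punchIn i) w) ≡ distinct w
  distinct-map-punchIn i []      = refl
  distinct-map-punchIn i (j ∷ w) rewrite notIn-map-punchIn i j w | distinct-map-punchIn i w = refl

  notIn⇒map-punchIn : (i : Fin (suc n)) (w : Vec (Fin (suc n)) k) → T (notIn i w) → ∃[ u ] Vec.map (punchIn i) u ≡ w
  notIn⇒map-punchIn i []      _ = [] , refl
  notIn⇒map-punchIn i (j ∷ w) i∉ with i ≟ j
  notIn⇒map-punchIn i (j ∷ w) () | yes _
  ... | no i≢j with notIn⇒map-punchIn i w i∉
  ...   | u , eq = punchOut i≢j ∷ u , cong₂ _∷_ (punchIn-punchOut i≢j) eq

  countLess : ℕ → Vec (Fin n) k → ℕ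
  countLess x []      = 0
  countLess x (j ∷ w) = (if toℕ j <ᵇ x then 1 else 0) + countLess x w

  countEq : ℕ → Vec (Fin n) k → ℕ
  countEq x []      = 0
  countEq x (j ∷ w) = (if toℕ j ≡ᵇ x then 1 else 0) + countEq x w

  <ᵇ-suc : ∀ a x → (if a <ᵇ suc x then 1 else 0) ≡ (if a <ᵇ x then 1 else 0) + (if a ≡ᵇ x then 1 else 0)
  <ᵇ-suc zero    zero    = refl
  <ᵇ-suc zero    (suc x) = refl
  <ᵇ-suc (suc a) zero    = refl
  <ᵇ-suc (suc a) (suc x) = <ᵇ-suc a x

  countLess-zero : (w : Vec (Fin n) k) → countLess 0 w ≡ 0
  countLess-zero []      = refl
  countLess-zero (j ∷ w) = countLess-zero w

  countLess-suc : ∀ x (w : Vec (Fin n) k) → countLess (suc x) w ≡ countLess x w + countEq x w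
  countLess-suc x []      = refl
  countLess-suc x (j ∷ w) rewrite <ᵇ-suc (toℕ j) x | countLess-suc x w =
    interchange (if toℕ j <ᵇ x then 1 else 0) (if toℕ j ≡ᵇ x then 1 else 0) (countLess x w) (countEq x w)

  countEq-notIn : (j : Fin n) (w : Vec (Fin n) k) → T (notIn j w) → countEq (toℕ j) w ≡ 0
  countEq-notIn j []      _   = refl
  countEq-notIn j (l ∷ w) j∉ with j ≟ l
  countEq-notIn j (l ∷ w) () | yes _
  ... | no j≢l rewrite dec-false (toℕ l ℕ.≟ toℕ j) (j≢l ∘ sym ∘ toℕ-injective) = countEq-notIn j w j∉

  countEq≤1 : ∀ x (w : Vec (Fin n) k) → T (distinct w) → countEq x w ≤ 1
  countEq≤1 x []      _ = z≤n
  countEq≤1 x (j ∷ w) d with toℕ j ≡ᵇ x in eq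
  ... | false = countEq≤1 x w (proj₂ (Equivalence.to T-∧ d))
  ... | true with ℕ.≡ᵇ⇒≡ (toℕ j) x (subst T (sym eq) _)
  ...   | refl rewrite countEq-notIn j w (proj₁ (Equivalence.to T-∧ d)) = s≤s z≤n

  countLess≤ : ∀ x (w : Vec (Fin n) k) → T (distinct w) → countLess x w ≤ x
  countLess≤ zero    w d rewrite countLess-zero w = z≤n
  countLess≤ (suc x) w d rewrite countLess-suc x w =
    subst (countLess x w + countEq x w ≤_) (ℕ.+-comm x 1)
      (ℕ.+-mono-≤ (countLess≤ x w d) (countEq≤1 x w d))

  countGreater-self-map-punchIn : (i : Fin (suc n)) (w : Vec (Fin n) k) →
    countGreater i (Vec.map (punchIn i) w) ≡ countLess (toℕ i) w
  countGreater-self-map-punchIn i []      = refl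
  countGreater-self-map-punchIn i (j ∷ w) rewrite toℕ-punchIn-<ᵇ i j | countGreater-self-map-punchIn i w = refl

  countGreater-map-punchIn : (i : Fin (suc n)) (j : Fin n) (w : Vec (Fin n) k) →
    countGreater (punchIn i j) (Vec.map (punchIn i) w) ≡ countGreater j w
  countGreater-map-punchIn i j []      = refl
  countGreater-map-punchIn i j (l ∷ w) rewrite toℕ-punchIn-<ᵇ-punchIn i l j | countGreater-map-punchIn i j w = refl

  inversions-map-punchIn : (i : Fin (suc n)) (w : Vec (Fin n) k) → inversions (Vec.map (punchIn i) w) ≡ inversions w
  inversions-map-punchIn i []      = refl
  inversions-map-punchIn i (j ∷ w) rewrite countGreater-map-punchIn i j w | inversions-map-punchIn i w = refl

  sumVals-map-punchIn : (i : Fin (suc n)) (w : Vec (Fin n) k) →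
    sumVals (Vec.map (punchIn i) w) + countLess (toℕ i) w ≡ sumVals w + k
  sumVals-map-punchIn i []      = refl
  sumVals-map-punchIn {k = suc k} i (j ∷ w) = begin
    (toℕ (punchIn i j) + sumVals (Vec.map (punchIn i) w)) + ((if toℕ j <ᵇ toℕ i then 1 else 0) + countLess (toℕ i) w)
      ≡⟨ interchange (toℕ (punchIn i j)) _ (if toℕ j <ᵇ toℕ i then 1 else 0) _ ⟩
    (toℕ (punchIn i j) + (if toℕ j <ᵇ toℕ i then 1 else 0)) + (sumVals (Vec.map (punchIn i) w) + countLess (toℕ i) w)
      ≡⟨ cong₂ _+_ (toℕ-punchIn i j) (sumVals-map-punchIn i w) ⟩
    suc (toℕ j + (sumVals w + k))
      ≡⟨ cong suc (sym (ℕ.+-assoc (toℕ j) (sumVals w) k)) ⟩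
    suc (toℕ j + sumVals w + k)
      ≡⟨ sym (ℕ.+-suc (toℕ j + sumVals w) k) ⟩
    toℕ j + sumVals w + suc k ∎
    where open ≡-Reasoning

  triangle≤sumVals : (w : Vec (Fin n) k) → T (distinct w) → triangle k ≤ sumVals w
  triangle≤sumVals []      _ = z≤n
  triangle≤sumVals {n = suc n} {k = suc k} (i ∷ w) d with notIn⇒map-punchIn i w (proj₁ (Equivalence.to T-∧ d))
  ... | u , refl = begin
    k + triangle k                    ≤⟨ ℕ.+-monoʳ-≤ k (triangle≤sumVals u u-distinct) ⟩
    k + sumVals u                     ≡⟨ ℕ.+-comm k (sumVals u) ⟩
    sumVals u + k                     ≡⟨ sumVals-map-punchIn i u ⟨
    sumVals w′ + countLess (toℕ i) u  ≤⟨ ℕ.+-monoʳ-≤ (sumVals w′) (countLess≤ (toℕ i) u u-distinct) ⟩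
    sumVals w′ + toℕ i                ≡⟨ ℕ.+-comm (sumVals w′) (toℕ i) ⟩
    toℕ i + sumVals w′                ∎
    where
    open ℕ.≤-Reasoning
    w′ : Vec (Fin (suc n)) k
    w′ = Vec.map (punchIn i) u
    u-distinct : T (distinct u)
    u-distinct = subst T (distinct-map-punchIn i u) (proj₂ (Equivalence.to T-∧ d))

  -- Mod 2, Σ (i_α - α) ≡ Σ i_α + Σ α; the sum avoids the truncated subtraction in shiftExp.
  signExponent : Vec (Fin n) k → ℕ
  signExponent {k = k} σ = inversions σ + (sumVals σ + triangle k)

  private
    signExponent-arith : ∀ c I t S′ S k Δ → S′ + c ≡ S + k →
      (c + I) + ((t + S′) + (k + Δ)) ≡ (t + (I + (S + Δ))) + (k + k)
    signExponent-arith c I t S′ S k Δ h = begin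
      (c + I) + ((t + S′) + (k + Δ))   ≡⟨ regroup c I t S′ k Δ ⟩
      (t + I + (Δ + k)) + (S′ + c)     ≡⟨ cong (t + I + (Δ + k) +_) h ⟩
      (t + I + (Δ + k)) + (S + k)      ≡⟨ collect I t S k Δ ⟩
      (t + (I + (S + Δ))) + (k + k)    ∎
      where
      open ≡-Reasoning
      regroup : ∀ c I t S′ k Δ → (c + I) + ((t + S′) + (k + Δ)) ≡ (t + I + (Δ + k)) + (S′ + c)
      regroup = solve-∀
      collect : ∀ I t S k Δ → (t + I + (Δ + k)) + (S + k) ≡ (t + (I + (S + Δ))) + (k + k)
      collect = solve-∀

  signExponent-cons-punchIn : (i : Fin (suc n)) (w : Vec (Fin n) k) →
    signExponent (i ∷ Vec.map (punchIn i) w) ≡ (toℕ i + signExponent w) + (k + k)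
  signExponent-cons-punchIn {k = k} i w
    rewrite countGreater-self-map-punchIn i w | inversions-map-punchIn i w =
    signExponent-arith (countLess (toℕ i) w) (inversions w) (toℕ i) (sumVals (Vec.map (punchIn i) w))
      (sumVals w) k (triangle k) (sumVals-map-punchIn i w)

  distinct-cons-map-punchIn : (i : Fin (suc n)) (w : Vec (Fin n) k) → distinct (i ∷ Vec.map (punchIn i) w) ≡ distinct w
  distinct-cons-map-punchIn i w rewrite notIn-self-map-punchIn i w = distinct-map-punchIn i w

  filterᵇ-unique : ∀ {a} {A : Set a} (p : A → Bool) (keep : List A → List A) → keep [] ≡ [] →
    (∀ x xs → keep (x ∷ xs) ≡ (if p x then x ∷ keep xs else keep xs)) →
    ∀ xs → keep xs ≡ List.filterᵇ p xs
  filterᵇ-unique p keep nil cons []       = nil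
  filterᵇ-unique p keep nil cons (x ∷ xs) rewrite cons x xs with p x
  ... | true  = cong (x ∷_) (filterᵇ-unique p keep nil cons xs)
  ... | false = filterᵇ-unique p keep nil cons xs

  -- `injections` filters through a helper local to its where-block, which cannot be
  -- named here; the metavariable `keep` is solved to it by unification.
  module _ (n k : ℕ) where
    mutual
      private
        keep : List (Vec (Fin n) k) → List (Vec (Fin n) k)
        keep = _

      injections≡filterᵇ : injections n k ≡ List.filterᵇ distinct (allVecs n k)
      injections≡filterᵇ with allVecs n k
      ... | vs = filterᵇ-unique distinct keep refl (λ _ _ → refl) vs

  parity-suc : ∀ n → parity (suc n) ≡ parity n ⁻¹
  parity-suc n = sym (suc-homo-⁻¹ (suc n))

  parity-suc-+-suc : ∀ m n → parity (suc m + suc n) ≡ parity (m + n)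
  parity-suc-+-suc m n = cong (parity ∘ suc) (ℕ.+-suc m n)

  %2≡1⇒parity≡1ℙ : ∀ n → n % 2 ≡ 1 → parity n ≡ 1ℙ
  %2≡1⇒parity≡1ℙ zero          ()
  %2≡1⇒parity≡1ℙ (suc zero)    _ = refl
  %2≡1⇒parity≡1ℙ (suc (suc n)) h = %2≡1⇒parity≡1ℙ n h

open IndexVectors

module VectorSums {c ℓ} (R : Semiring c ℓ) where
  open Semiring R hiding (zero)
  open import Algebra.Properties.Semiring.Sum R
  open import Relation.Binary.Reasoning.Setoid setoid

  ∑List : ∀ {a} {A : Set a} → (A → Carrier) → List A → Carrier
  ∑List f = foldr (λ x s → f x + s) 0#

  ∑List-++ : ∀ {a} {A : Set a} (f : A → Carrier) xs ys → ∑List f (xs ++ ys) ≈ ∑List f xs + ∑List f ys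
  ∑List-++ f []       ys = sym (+-identityˡ _)
  ∑List-++ f (x ∷ xs) ys = trans (+-congˡ (∑List-++ f xs ys)) (sym (+-assoc _ _ _))

  ∑List-concatMap : ∀ {a b} {A : Set a} {B : Set b} (f : B → Carrier) (g : A → List B) xs →
    ∑List f (concatMap g xs) ≈ ∑List (∑List f ∘ g) xs
  ∑List-concatMap f g []       = refl
  ∑List-concatMap f g (x ∷ xs) = trans (∑List-++ f (g x) _) (+-congˡ (∑List-concatMap f g xs))

  ∑List-tabulate : ∀ {a} {A : Set a} {n} (f : A → Carrier) (g : Fin n → A) →
    ∑List f (List.tabulate g) ≡ ∑[ i < n ] f (g i)
  ∑List-tabulate {n = zero}  f g = ≡.refl
  ∑List-tabulate {n = suc n} f g = ≡.cong (f (g zero) +_) (∑List-tabulate f (g ∘ suc))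

  ∑List-cong : ∀ {a} {A : Set a} {f g : A → Carrier} xs → (∀ x → f x ≈ g x) → ∑List f xs ≈ ∑List g xs
  ∑List-cong []       f≈g = refl
  ∑List-cong (x ∷ xs) f≈g = +-cong (f≈g x) (∑List-cong xs f≈g)

  ∑List-map-allFin : ∀ {a} {A : Set a} {n} (f : A → Carrier) (g : Fin n → A) →
    ∑List f (List.map g (allFin n)) ≡ ∑[ i < n ] f (g i)
  ∑List-map-allFin f g = ≡.trans (≡.cong (∑List f) (map-tabulate id g)) (∑List-tabulate f g)

  ∑List-filterᵇ : ∀ {a} {A : Set a} (p : A → Bool) (f : A → Carrier) xs →
    ∑List f (List.filterᵇ p xs) ≈ ∑List (λ x → if p x then f x else 0#) xs
  ∑List-filterᵇ p f []       = refl
  ∑List-filterᵇ p f (x ∷ xs) with p x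
  ... | true  = +-congˡ (∑List-filterᵇ p f xs)
  ... | false = trans (∑List-filterᵇ p f xs) (sym (+-identityˡ _))

  ∑-if : ∀ {n} b (f : Fin n → Carrier) → ∑[ i < n ] (if b then f i else 0#) ≈ (if b then ∑[ i < n ] f i else 0#)
  ∑-if true  f = refl
  ∑-if {n} false f = sum-replicate-zero n

  ∑Vec : ∀ n k → (Vec (Fin n) k → Carrier) → Carrier
  ∑Vec n zero    f = f []
  ∑Vec n (suc k) f = ∑Vec n k (λ v → ∑[ i < n ] f (i ∷ v))

  ∑Vec-cong : ∀ {n} k {f g : Vec (Fin n) k → Carrier} → (∀ v → f v ≈ g v) → ∑Vec n k f ≈ ∑Vec n k g
  ∑Vec-cong zero    f≈g = f≈g []
  ∑Vec-cong (suc k) f≈g = ∑Vec-cong k (λ v → sum-cong-≋ (λ i → f≈g (i ∷ v)))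

  ∑List-allVecs : ∀ n k (f : Vec (Fin n) k → Carrier) → ∑List f (allVecs n k) ≈ ∑Vec n k f
  ∑List-allVecs n zero    f = +-identityʳ (f [])
  ∑List-allVecs n (suc k) f = begin
    ∑List f (concatMap (λ v → List.map (_∷ v) (allFin n)) (allVecs n k))
      ≈⟨ ∑List-concatMap f _ (allVecs n k) ⟩
    ∑List (λ v → ∑List f (List.map (_∷ v) (allFin n))) (allVecs n k)
      ≈⟨ ∑List-cong (allVecs n k) (λ v → reflexive (∑List-map-allFin f (_∷ v))) ⟩
    ∑List (λ v → ∑[ i < n ] f (i ∷ v)) (allVecs n k)
      ≈⟨ ∑List-allVecs n k _ ⟩
    ∑Vec n (suc k) f ∎

  ∑Vec-∑-comm : ∀ {m n} k (g : Fin m → Vec (Fin n) k → Carrier) →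
    ∑Vec n k (λ v → ∑[ i < m ] g i v) ≈ ∑[ i < m ] ∑Vec n k (g i)
  ∑Vec-∑-comm zero    g = refl
  ∑Vec-∑-comm {n = n} (suc k) g =
    trans (∑Vec-cong k (λ v → ∑-comm (λ j i → g i (j ∷ v)))) (∑Vec-∑-comm k (λ i v → ∑[ j < n ] g i (j ∷ v)))

  ∑Vec-cons : ∀ {n} k (f : Vec (Fin n) (suc k) → Carrier) →
    ∑Vec n (suc k) f ≈ ∑[ i < n ] ∑Vec n k (λ v → f (i ∷ v))
  ∑Vec-cons k f = ∑Vec-∑-comm k (λ i v → f (i ∷ v))

  *-distribˡ-∑Vec : ∀ {n} k x (f : Vec (Fin n) k → Carrier) → x * ∑Vec n k f ≈ ∑Vec n k (λ v → x * f v)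
  *-distribˡ-∑Vec zero    x f = refl
  *-distribˡ-∑Vec {n} (suc k) x f =
    trans (*-distribˡ-∑Vec k x _) (∑Vec-cong k (λ v → *-distribˡ-sum {n} x (λ i → f (i ∷ v))))

  ∑-avoiding : ∀ {n k} (i : Fin (suc n)) (v : Vec (Fin (suc n)) k)
    (f : Vec (Fin (suc n)) (suc k) → Carrier) →
    ∑[ j < suc n ] (if notIn i (j ∷ v) then f (j ∷ v) else 0#)
      ≈ (if notIn i v then ∑[ j < n ] f (punchIn i j ∷ v) else 0#)
  ∑-avoiding {n} i v f = begin
    ∑[ j < suc n ] g j                                    ≈⟨ sum-remove {i = i} g ⟩
    g i + ∑[ j < n ] g (punchIn i j)                      ≡⟨ ≡.cong₂ _+_ g-self (sum-cong-≗ g-punchIn) ⟩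
    0# + ∑[ j < n ] (if notIn i v then f′ j else 0#)      ≈⟨ +-identityˡ _ ⟩
    ∑[ j < n ] (if notIn i v then f′ j else 0#)           ≈⟨ ∑-if (notIn i v) f′ ⟩
    (if notIn i v then ∑[ j < n ] f′ j else 0#)           ∎
    where
    f′ : Fin n → Carrier
    f′ j = f (punchIn i j ∷ v)
    g : Fin (suc n) → Carrier
    g j = if notIn i (j ∷ v) then f (j ∷ v) else 0#
    g-self : g i ≡ 0#
    g-self = ≡.cong (if_then f (i ∷ v) else 0#) (notIn-cons-self i v)
    g-punchIn : ∀ j → g (punchIn i j) ≡ (if notIn i v then f′ j else 0#)
    g-punchIn j = ≡.cong (if_then f′ j else 0#) (notIn-cons-punchIn i j v)

  ∑Vec-avoiding : ∀ {n} k (i : Fin (suc n)) (f : Vec (Fin (suc n)) k → Carrier) →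
    ∑Vec (suc n) k (λ v → if notIn i v then f v else 0#) ≈ ∑Vec n k (f ∘ Vec.map (punchIn i))
  ∑Vec-avoiding zero    i f = refl
  ∑Vec-avoiding (suc k) i f = trans (∑Vec-cong k (λ v → ∑-avoiding i v f))
                                    (∑Vec-avoiding k i (λ v → ∑[ j < _ ] f (punchIn i j ∷ v)))

module RingSums {c ℓ} (R : Ring c ℓ) where
  open Ring R hiding (zero)
  open import Algebra.Properties.Ring R
    using (-‿distribˡ-*; -‿distribʳ-*; -‿involutive; -‿+-comm; -0#≈0#; +-cancelˡ)
  open import Algebra.Properties.Semiring.Sum semiring
  open import Relation.Binary.Reasoning.Setoid setoid

  -x*-y≈x*y : ∀ x y → - x * - y ≈ x * y
  -x*-y≈x*y x y = trans (sym (-‿distribˡ-* x (- y))) (trans (-‿cong (sym (-‿distribʳ-* x y))) (-‿involutive _))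

  ∑-neg : ∀ {n} (f : Vector Carrier n) → ∑[ i < n ] (- f i) ≈ - ∑[ i < n ] f i
  ∑-neg {zero}  f = sym -0#≈0#
  ∑-neg {suc n} f = trans (+-congˡ (∑-neg (f ∘ suc))) (-‿+-comm _ _)

  ∑[f-c*g]≈∑f-c*∑g : ∀ {n} (f : Vector Carrier n) c g → ∑[ i < n ] (f i - c * g i) ≈ sum f - c * sum g
  ∑[f-c*g]≈∑f-c*∑g {n} f c g = begin
    ∑[ i < n ] (f i - c * g i)          ≈⟨ ∑-distrib-+ f (λ i → - (c * g i)) ⟩
    sum f + ∑[ i < n ] (- (c * g i))    ≈⟨ +-congˡ (∑-neg (λ i → c * g i)) ⟩
    sum f - ∑[ i < n ] (c * g i)        ≈⟨ +-congˡ (-‿cong (*-distribˡ-sum c g)) ⟨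
    sum f - c * sum g                   ∎

  -- Both sides are the full double sum of φ minus its diagonal.
  ∑-comm-offDiagonal : ∀ {n} (φ : Fin (suc n) → Fin (suc n) → Carrier) →
    ∑[ p < suc n ] ∑[ a < n ] φ p (punchIn p a) ≈ ∑[ q < suc n ] ∑[ b < n ] φ (punchIn q b) q
  ∑-comm-offDiagonal {n} φ = +-cancelˡ diagonal _ _ (begin
    diagonal + ∑[ p < suc n ] byRow p          ≈⟨ ∑-distrib-+ (λ p → φ p p) byRow ⟨
    ∑[ p < suc n ] (φ p p + byRow p)           ≈⟨ sum-cong-≋ (λ p → sum-remove {i = p} (φ p)) ⟨
    ∑[ p < suc n ] ∑[ q < suc n ] φ p q        ≈⟨ ∑-comm φ ⟩
    ∑[ q < suc n ] ∑[ p < suc n ] φ p q        ≈⟨ sum-cong-≋ (λ q → sum-remove {i = q} (λ p → φ p q)) ⟩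
    ∑[ q < suc n ] (φ q q + byColumn q)        ≈⟨ ∑-distrib-+ (λ q → φ q q) byColumn ⟩
    diagonal + ∑[ q < suc n ] byColumn q       ∎)
    where
    diagonal : Carrier
    diagonal = ∑[ p < suc n ] φ p p
    byRow byColumn : Fin (suc n) → Carrier
    byRow p = ∑[ a < n ] φ p (punchIn p a)
    byColumn q = ∑[ b < n ] φ (punchIn q b) q

minor : ∀ {a} {A : Set a} {n k} → Fin (suc n) → Mat A (suc n) (suc k) → Mat A n k
minor i X = removeAt (Vector.map tail X) i

module _ {c ℓ} (F : Field c ℓ) where
  open Field F hiding (zero)
  open import Algebra.Properties.Ring ring
    using (-‿distribˡ-*; -‿distribʳ-*; -‿involutive; -0#≈0#; x[y-z]≈xy-xz; [y-z]x≈yx-zx; +-inverseˡ-unique)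
  open import Algebra.Properties.Semiring.Sum semiring
  open RingSums ring
  open VectorSums semiring
  open CommutativeSemigroupProperties *-commutativeSemigroup using (x∙yz≈y∙xz)
  open import Relation.Binary.Reasoning.Setoid setoid

  -1^_ : ℕ → Carrier
  -1^_ = negOnePow F

  -1^-+ : ∀ a b → -1^ (a ℕ.+ b) ≈ -1^ a * -1^ b
  -1^-+ zero    b = sym (*-identityˡ _)
  -1^-+ (suc a) b = trans (-‿cong (-1^-+ a b)) (-‿distribˡ-* _ _)

  -1^-square : ∀ a → -1^ a * -1^ a ≈ 1#
  -1^-square zero    = *-identityˡ 1#
  -1^-square (suc a) = trans (-x*-y≈x*y _ _) (-1^-square a)

  -1^-double : ∀ a → -1^ (a ℕ.+ a) ≈ 1#
  -1^-double a = trans (-1^-+ a a) (-1^-square a)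

  -1^-∸ : ∀ {a b} → b ≤ a → -1^ (a ∸ b) ≈ -1^ (a ℕ.+ b)
  -1^-∸ {a} {b} b≤a = begin
    -1^ (a ∸ b)                          ≈⟨ *-identityʳ _ ⟨
    -1^ (a ∸ b) * 1#                     ≈⟨ *-congˡ (-1^-square b) ⟨
    -1^ (a ∸ b) * (-1^ b * -1^ b)        ≈⟨ *-assoc _ _ _ ⟨
    -1^ (a ∸ b) * -1^ b * -1^ b          ≈⟨ *-congʳ (-1^-+ (a ∸ b) b) ⟨
    -1^ (a ∸ b ℕ.+ b) * -1^ b              ≡⟨ ≡.cong (λ x → -1^ x * -1^ b) (ℕ.m∸n+n≡m b≤a) ⟩
    -1^ a * -1^ b                        ≈⟨ -1^-+ a b ⟨
    -1^ (a ℕ.+ b)                          ∎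

  sgnnk≈-1^signExponent : ∀ {n k} (σ : Vec (Fin n) k) → T (distinct σ) → sgnnk F σ ≈ -1^ signExponent σ
  sgnnk≈-1^signExponent {k = k} σ d =
    trans (*-congˡ (-1^-∸ (triangle≤sumVals σ d))) (sym (-1^-+ (inversions σ) (sumVals σ ℕ.+ triangle k)))

  sgnnk-cons-punchIn : ∀ {n k} (i : Fin (suc n)) (w : Vec (Fin n) k) → T (distinct w) →
    sgnnk F (i ∷ Vec.map (punchIn i) w) ≈ -1^ toℕ i * sgnnk F w
  sgnnk-cons-punchIn {k = k} i w d = begin
    sgnnk F (i ∷ Vec.map (punchIn i) w)              ≈⟨ sgnnk≈-1^signExponent (i ∷ Vec.map (punchIn i) w) d′ ⟩
    -1^ signExponent (i ∷ Vec.map (punchIn i) w)     ≡⟨ ≡.cong -1^_ (signExponent-cons-punchIn i w) ⟩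
    -1^ (toℕ i ℕ.+ signExponent w ℕ.+ (k ℕ.+ k))     ≈⟨ -1^-+ (toℕ i ℕ.+ signExponent w) (k ℕ.+ k) ⟩
    -1^ (toℕ i ℕ.+ signExponent w) * -1^ (k ℕ.+ k)   ≈⟨ *-congˡ (-1^-double k) ⟩
    -1^ (toℕ i ℕ.+ signExponent w) * 1#              ≈⟨ *-identityʳ _ ⟩
    -1^ (toℕ i ℕ.+ signExponent w)                   ≈⟨ -1^-+ (toℕ i) (signExponent w) ⟩
    -1^ toℕ i * -1^ signExponent w                   ≈⟨ *-congˡ (sgnnk≈-1^signExponent w d) ⟨
    -1^ toℕ i * sgnnk F w                            ∎
    where
    d′ : T (distinct (i ∷ Vec.map (punchIn i) w))
    d′ = ≡.subst T (≡.sym (distinct-cons-map-punchIn i w)) d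

  diagProd-map : ∀ {m n k} (X : Mat Carrier n k) (g : Fin m → Fin n) (σ : Vec (Fin m) k) →
    diagProd F X (Vec.map g σ) ≡ diagProd F (X ∘ g) σ
  diagProd-map X g []      = ≡.refl
  diagProd-map X g (i ∷ σ) = ≡.cong (X (g i) zero *_) (diagProd-map (Vector.map tail X) g σ)

  cullisTerm : ∀ {n k} → Mat Carrier n k → Vec (Fin n) k → Carrier
  cullisTerm X σ = if distinct σ then sgnnk F σ * diagProd F X σ else 0#

  detCullis≈∑Vec : ∀ n k (X : Mat Carrier n k) → detCullis F n k X ≈ ∑Vec n k (cullisTerm X)
  detCullis≈∑Vec n k X = begin
    detCullis F n k X                                   ≡⟨ ≡.cong (∑List term) (injections≡filterᵇ n k) ⟩
    ∑List term (List.filterᵇ distinct (allVecs n k))    ≈⟨ ∑List-filterᵇ distinct term (allVecs n k) ⟩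
    ∑List (cullisTerm X) (allVecs n k)                  ≈⟨ ∑List-allVecs n k (cullisTerm X) ⟩
    ∑Vec n k (cullisTerm X)                             ∎
    where
    term : Vec (Fin n) k → Carrier
    term σ = sgnnk F σ * diagProd F X σ

  consTerm : ∀ {n k} → Mat Carrier n (suc k) → Fin n → Vec (Fin n) k → Carrier
  consTerm X i v = if distinct v then sgnnk F (i ∷ v) * diagProd F X (i ∷ v) else 0#

  cullisTerm-cons : ∀ {n k} (X : Mat Carrier n (suc k)) (i : Fin n) (v : Vec (Fin n) k) →
    cullisTerm X (i ∷ v) ≡ (if notIn i v then consTerm X i v else 0#)
  cullisTerm-cons X i v with notIn i v
  ... | true  = ≡.refl
  ... | false = ≡.refl

  consTerm-map-punchIn : ∀ {n k} (X : Mat Carrier (suc n) (suc k)) (i : Fin (suc n)) (w : Vec (Fin n) k) →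
    consTerm X i (Vec.map (punchIn i) w) ≈ -1^ toℕ i * (X i zero * cullisTerm (minor i X) w)
  consTerm-map-punchIn X i w rewrite distinct-map-punchIn i w with distinct w in w-distinct
  ... | false = sym (trans (*-congˡ (zeroʳ _)) (zeroʳ _))
  ... | true  = begin
    sgnnk F (i ∷ Vec.map (punchIn i) w) * (X i zero * diagProd F (Vector.map tail X) (Vec.map (punchIn i) w))
      ≈⟨ *-cong (sgnnk-cons-punchIn i w (≡.subst T (≡.sym w-distinct) _))
                (*-congˡ (reflexive (diagProd-map (Vector.map tail X) (punchIn i) w))) ⟩
    -1^ toℕ i * sgnnk F w * (X i zero * diagProd F (minor i X) w)
      ≈⟨ *-assoc _ _ _ ⟩
    -1^ toℕ i * (sgnnk F w * (X i zero * diagProd F (minor i X) w))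
      ≈⟨ *-congˡ (x∙yz≈y∙xz _ _ _) ⟩
    -1^ toℕ i * (X i zero * (sgnnk F w * diagProd F (minor i X) w)) ∎

  detCullis-expand : ∀ n k (X : Mat Carrier (suc n) (suc k)) →
    detCullis F (suc n) (suc k) X ≈ ∑[ i < suc n ] (-1^ toℕ i * (X i zero * detCullis F n k (minor i X)))
  detCullis-expand n k X = begin
    detCullis F (suc n) (suc k) X                                ≈⟨ detCullis≈∑Vec (suc n) (suc k) X ⟩
    ∑Vec (suc n) (suc k) (cullisTerm X)                          ≈⟨ ∑Vec-cons k (cullisTerm X) ⟩
    ∑[ i < suc n ] ∑Vec (suc n) k (λ v → cullisTerm X (i ∷ v))  ≈⟨ sum-cong-≋ row ⟩
    ∑[ i < suc n ] (-1^ toℕ i * (X i zero * detCullis F n k (minor i X))) ∎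
    where
    row : ∀ i → ∑Vec (suc n) k (λ v → cullisTerm X (i ∷ v)) ≈ -1^ toℕ i * (X i zero * detCullis F n k (minor i X))
    row i = begin
      ∑Vec (suc n) k (λ v → cullisTerm X (i ∷ v))
        ≈⟨ ∑Vec-cong k (reflexive ∘ cullisTerm-cons X i) ⟩
      ∑Vec (suc n) k (λ v → if notIn i v then consTerm X i v else 0#)
        ≈⟨ ∑Vec-avoiding k i (consTerm X i) ⟩
      ∑Vec n k (consTerm X i ∘ Vec.map (punchIn i))
        ≈⟨ ∑Vec-cong k (consTerm-map-punchIn X i) ⟩
      ∑Vec n k (λ w → -1^ toℕ i * (X i zero * cullisTerm (minor i X) w))
        ≈⟨ trans (*-congˡ (*-distribˡ-∑Vec k (X i zero) _)) (*-distribˡ-∑Vec k (-1^ toℕ i) _) ⟨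
      -1^ toℕ i * (X i zero * ∑Vec n k (cullisTerm (minor i X)))
        ≈⟨ *-congˡ (*-congˡ (detCullis≈∑Vec n k (minor i X))) ⟨
      -1^ toℕ i * (X i zero * detCullis F n k (minor i X))
        ∎

  laplaceDet : ∀ n k → Mat Carrier n k → Carrier
  laplaceDet n       zero    X = 1#
  laplaceDet zero    (suc k) X = 0#
  laplaceDet (suc n) (suc k) X = ∑[ i < suc n ] (-1^ toℕ i * (X i zero * laplaceDet n k (minor i X)))

  laplaceDet-cong : ∀ n k {X Y : Mat Carrier n k} → (∀ r c → X r c ≈ Y r c) → laplaceDet n k X ≈ laplaceDet n k Y
  laplaceDet-cong n       zero    X≈Y = refl
  laplaceDet-cong zero    (suc k) X≈Y = refl
  laplaceDet-cong (suc n) (suc k) X≈Y =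
    sum-cong-≋ (λ i → *-congˡ {x = -1^ toℕ i}
                         (*-cong (X≈Y i zero) (laplaceDet-cong n k (λ r c → X≈Y (punchIn i r) (suc c)))))

  detCullis≈laplaceDet : ∀ n k (X : Mat Carrier n k) → detCullis F n k X ≈ laplaceDet n k X
  detCullis≈laplaceDet n zero X = trans (detCullis≈∑Vec n zero X) (trans (*-identityʳ _) (*-identityʳ _))
  detCullis≈laplaceDet zero (suc k) X = trans (detCullis≈∑Vec zero (suc k) X) (∑Vec-cons k (cullisTerm X))
  detCullis≈laplaceDet (suc n) (suc k) X = trans (detCullis-expand n k X)
    (sum-cong-≋ (λ i → *-congˡ {x = -1^ toℕ i} (*-congˡ {x = X i zero} (detCullis≈laplaceDet n k (minor i X)))))

  ∑-alternating≈0 : ∀ n → parity n ≡ 0ℙ → ∑[ p < n ] -1^ toℕ p ≈ 0#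
  ∑-alternating≈0 zero          _     = refl
  ∑-alternating≈0 (suc zero)    ()
  ∑-alternating≈0 (suc (suc n)) n-even = begin
    1# + (- 1# + ∑[ p < n ] (- - -1^ toℕ p))
      ≈⟨ +-congˡ (+-congˡ (sum-cong-≋ {n} (λ p → -‿involutive (-1^ toℕ p)))) ⟩
    1# + (- 1# + ∑[ p < n ] -1^ toℕ p)     ≈⟨ +-assoc _ _ _ ⟨
    1# + - 1# + ∑[ p < n ] -1^ toℕ p       ≈⟨ +-congʳ (-‿inverseʳ 1#) ⟩
    0# + ∑[ p < n ] -1^ toℕ p              ≈⟨ +-identityˡ _ ⟩
    ∑[ p < n ] -1^ toℕ p                   ≈⟨ ∑-alternating≈0 n n-even ⟩
    0#                                     ∎

  -1^-punchIn-punchOut′ : ∀ {n} (i : Fin (suc (suc n))) (j : Fin (suc n)) →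
    -1^ toℕ (punchIn i j) * -1^ toℕ (punchOut′ (punchIn i j) i) ≈ - (-1^ toℕ i * -1^ toℕ j)
  -1^-punchIn-punchOut′ zero j =
    trans (*-identityʳ _) (-‿cong (sym (*-identityˡ _)))
  -1^-punchIn-punchOut′ (suc i) zero =
    trans (*-identityˡ _) (sym (trans (-‿cong (*-identityʳ _)) (-‿involutive _)))
  -1^-punchIn-punchOut′ {suc n} (suc i) (suc j) =
    trans (-x*-y≈x*y _ _) (trans (-1^-punchIn-punchOut′ i j) (-‿cong (sym (-x*-y≈x*y _ _))))

  -- laplaceDet (suc m) (suc j) of Y with a column of ones prepended.
  rowMinorSum : ∀ m j → Mat Carrier (suc m) j → Carrier
  rowMinorSum m j Y = ∑[ p < suc m ] (-1^ toℕ p * laplaceDet m j (removeAt Y p))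

  rowMinorSum-expand : ∀ m j (Y : Mat Carrier (suc (suc m)) (suc j)) →
    rowMinorSum (suc m) (suc j) Y ≈ ∑[ q < suc (suc m) ] (- (-1^ toℕ q * (Y q zero * rowMinorSum m j (minor q Y))))
  rowMinorSum-expand m j Y = begin
    rowMinorSum (suc m) (suc j) Y                               ≈⟨ sum-cong-≋ {suc (suc m)} expand ⟩
    ∑[ p < suc (suc m) ] ∑[ a < suc m ] φ p (punchIn p a)        ≈⟨ ∑-comm-offDiagonal φ ⟩
    ∑[ q < suc (suc m) ] ∑[ b < suc m ] φ (punchIn q b) q        ≈⟨ sum-cong-≋ {suc (suc m)} column ⟩
    ∑[ q < suc (suc m) ] (- (-1^ toℕ q * (Y q zero * rowMinorSum m j (minor q Y)))) ∎
    where
    -- φ p q: the term of the double expansion that deletes row p, then row q.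
    φ : Fin (suc (suc m)) → Fin (suc (suc m)) → Carrier
    φ p q = -1^ toℕ p * (-1^ toℕ (punchOut′ p q) * (Y q zero * laplaceDet m j (minor (punchOut′ p q) (removeAt Y p))))

    M : Fin (suc (suc m)) → Fin (suc m) → Carrier
    M q b = laplaceDet m j (removeAt (minor q Y) b)

    φ-punchIn : ∀ p a →
      φ p (punchIn p a) ≡ -1^ toℕ p * (-1^ toℕ a * (Y (punchIn p a) zero * laplaceDet m j (minor a (removeAt Y p))))
    φ-punchIn p a rewrite punchOut′-punchIn p a = ≡.refl

    expand : ∀ p → -1^ toℕ p * laplaceDet (suc m) (suc j) (removeAt Y p) ≈ ∑[ a < suc m ] φ p (punchIn p a)
    expand p = trans (*-distribˡ-sum (-1^ toℕ p) terms) (reflexive (sum-cong-≗ {suc m} (≡.sym ∘ φ-punchIn p)))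
      where
      terms : Fin (suc m) → Carrier
      terms a = -1^ toℕ a * (Y (punchIn p a) zero * laplaceDet m j (minor a (removeAt Y p)))

    φ-transpose : ∀ q b → φ (punchIn q b) q ≈ - (-1^ toℕ q * (Y q zero * (-1^ toℕ b * M q b)))
    φ-transpose q b = begin
      s₁ * (s₂ * (y * laplaceDet m j (minor (punchOut′ (punchIn q b) q) (removeAt Y (punchIn q b)))))
        ≈⟨ *-congˡ (*-congˡ (*-congˡ (laplaceDet-cong m j same-rows))) ⟩
      s₁ * (s₂ * (y * M q b))         ≈⟨ *-assoc _ _ _ ⟨
      s₁ * s₂ * (y * M q b)           ≈⟨ *-congʳ (-1^-punchIn-punchOut′ q b) ⟩
      - (sq * sb) * (y * M q b)       ≈⟨ -‿distribˡ-* _ _ ⟨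
      - (sq * sb * (y * M q b))       ≈⟨ -‿cong (trans (*-assoc _ _ _) (*-congˡ (x∙yz≈y∙xz _ _ _))) ⟩
      - (sq * (y * (sb * M q b)))     ∎
      where
      s₁ s₂ sq sb y : Carrier
      s₁ = -1^ toℕ (punchIn q b)
      s₂ = -1^ toℕ (punchOut′ (punchIn q b) q)
      sq = -1^ toℕ q
      sb = -1^ toℕ b
      y = Y q zero
      same-rows : ∀ r c → minor (punchOut′ (punchIn q b) q) (removeAt Y (punchIn q b)) r c ≈ removeAt (minor q Y) b r c
      same-rows r c = reflexive (≡.cong (λ x → Y x (suc c)) (punchIn-punchIn-punchOut′ q b r))

    column : ∀ q → ∑[ b < suc m ] φ (punchIn q b) q ≈ - (-1^ toℕ q * (Y q zero * rowMinorSum m j (minor q Y)))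
    column q = begin
      ∑[ b < suc m ] φ (punchIn q b) q          ≈⟨ sum-cong-≋ {suc m} (φ-transpose q) ⟩
      ∑[ b < suc m ] (- (sq * (y * t b)))        ≈⟨ ∑-neg (λ b → sq * (y * t b)) ⟩
      - ∑[ b < suc m ] (sq * (y * t b))          ≈⟨ -‿cong (*-distribˡ-sum sq (λ b → y * t b)) ⟨
      - (sq * ∑[ b < suc m ] (y * t b))          ≈⟨ -‿cong (*-congˡ (*-distribˡ-sum y t)) ⟨
      - (sq * (y * rowMinorSum m j (minor q Y))) ∎
      where
      sq y : Carrier
      sq = -1^ toℕ q
      y = Y q zero
      t : Fin (suc m) → Carrier
      t b = -1^ toℕ b * M q b

  rowMinorSum≈0 : ∀ m j → parity (m ℕ.+ j) ≡ 1ℙ → (Y : Mat Carrier (suc m) j) → rowMinorSum m j Y ≈ 0#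
  rowMinorSum≈0 m zero m-odd Y =
    trans (sum-cong-≋ {suc m} (λ p → *-identityʳ (-1^ toℕ p))) (∑-alternating≈0 (suc m) suc-m-even)
    where
    suc-m-even : parity (suc m) ≡ 0ℙ
    suc-m-even = ≡.trans (parity-suc m) (≡.cong _⁻¹ (≡.trans (≡.cong parity (≡.sym (ℕ.+-identityʳ m))) m-odd))
  rowMinorSum≈0 zero    (suc j) _       Y = trans (+-identityʳ _) (zeroʳ _)
  rowMinorSum≈0 (suc m) (suc j) m+j-odd Y = begin
    rowMinorSum (suc m) (suc j) Y                         ≈⟨ rowMinorSum-expand m j Y ⟩
    ∑[ q < suc (suc m) ] (- (-1^ toℕ q * (Y q zero * rowMinorSum m j (minor q Y))))
                                                          ≈⟨ sum-cong-≋ {suc (suc m)} vanish ⟩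
    ∑[ q < suc (suc m) ] 0#                               ≈⟨ sum-replicate-zero (suc (suc m)) ⟩
    0#                                                    ∎
    where
    m+j-odd′ : parity (m ℕ.+ j) ≡ 1ℙ
    m+j-odd′ = ≡.trans (≡.sym (parity-suc-+-suc m j)) m+j-odd
    vanish : ∀ q → - (-1^ toℕ q * (Y q zero * rowMinorSum m j (minor q Y))) ≈ 0#
    vanish q = begin
      - (-1^ toℕ q * (Y q zero * rowMinorSum m j (minor q Y)))
        ≈⟨ -‿cong (*-congˡ (*-congˡ (rowMinorSum≈0 m j m+j-odd′ (minor q Y)))) ⟩
      - (-1^ toℕ q * (Y q zero * 0#))  ≈⟨ -‿cong (trans (*-congˡ (zeroʳ _)) (zeroʳ _)) ⟩
      - 0#                             ≈⟨ -0#≈0# ⟩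
      0#                               ∎

  minor-Lminus : ∀ {n k} (i : Fin (suc n)) (X : Mat Carrier (suc (suc n)) (suc k)) r c →
    minor i (Lminus F X) r c ≡ Lminus F (minor (inject₁ i) X) r c
  minor-Lminus i X r c =
    ≡.cong₂ (λ p q → X p (suc c) - X q (suc c)) (≡.sym (punchIn-inject₁ i r)) (≡.sym (punchIn-inject₁-fromℕ i))

  x[[y-z]w]≈x[yw]-z[xw] : ∀ x y z w → x * ((y - z) * w) ≈ x * (y * w) - z * (x * w)
  x[[y-z]w]≈x[yw]-z[xw] x y z w = begin
    x * ((y - z) * w)          ≈⟨ *-congˡ ([y-z]x≈yx-zx w y z) ⟩
    x * (y * w - z * w)        ≈⟨ x[y-z]≈xy-xz x (y * w) (z * w) ⟩
    x * (y * w) - x * (z * w)  ≈⟨ +-congˡ (-‿cong (x∙yz≈y∙xz x z w)) ⟩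
    x * (y * w) - z * (x * w)  ∎

  laplaceDet-Lminus : ∀ n k → parity (n ℕ.+ k) ≡ 0ℙ → (X : Mat Carrier (suc n) k) →
    laplaceDet n k (Lminus F X) ≈ laplaceDet (suc n) k X
  laplaceDet-Lminus n       zero          _  X = refl
  laplaceDet-Lminus zero    (suc zero)    ()
  laplaceDet-Lminus zero    (suc (suc k)) _  X = sym (trans (+-identityʳ _) (trans (*-congˡ (zeroʳ _)) (zeroʳ _)))
  laplaceDet-Lminus (suc n) (suc k) n+k-even X = begin
    laplaceDet (suc n) (suc k) (Lminus F X)   ≈⟨ sum-cong-≋ {suc n} row ⟩
    ∑[ i < suc n ] (init u i - b * init t i)  ≈⟨ ∑[f-c*g]≈∑f-c*∑g (init u) b (init t) ⟩
    sum (init u) - b * sum (init t)           ≈⟨ +-congˡ (-‿cong (*-congˡ ∑-init-t)) ⟩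
    sum (init u) - b * - last t               ≈⟨ +-congˡ (-‿cong (-‿distribʳ-* b (last t))) ⟨
    sum (init u) - - (b * last t)             ≈⟨ +-congˡ (-‿involutive _) ⟩
    sum (init u) + b * last t                 ≈⟨ +-congˡ (x∙yz≈y∙xz b _ _) ⟩
    sum (init u) + last u                     ≈⟨ sum-init-last u ⟨
    laplaceDet (suc (suc n)) (suc k) X        ∎
    where
    D t u : Vector Carrier (suc (suc n))
    D p = laplaceDet (suc n) k (minor p X)
    t p = -1^ toℕ p * D p
    u p = -1^ toℕ p * (X p zero * D p)
    b : Carrier
    b = X (fromℕ (suc n)) zero

    n+k-even′ : parity (n ℕ.+ k) ≡ 0ℙ
    n+k-even′ = ≡.trans (≡.sym (parity-suc-+-suc n k)) n+k-even

    ∑-init-t : sum (init t) ≈ - last t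
    ∑-init-t = +-inverseˡ-unique _ _ (trans (sym (sum-init-last t)) (rowMinorSum≈0 (suc n) k odd (Vector.map tail X)))
      where
      odd : parity (suc n ℕ.+ k) ≡ 1ℙ
      odd = ≡.trans (parity-suc (n ℕ.+ k)) (≡.cong _⁻¹ n+k-even′)

    row : ∀ i → -1^ toℕ i * (Lminus F X i zero * laplaceDet n k (minor i (Lminus F X))) ≈ init u i - b * init t i
    row i = begin
      -1^ toℕ i * ((X (inject₁ i) zero - b) * laplaceDet n k (minor i (Lminus F X)))
        ≈⟨ *-congˡ (*-congˡ (trans (laplaceDet-cong n k (λ r c → reflexive (minor-Lminus i X r c)))
                                   (laplaceDet-Lminus n k n+k-even′ (minor (inject₁ i) X)))) ⟩
      -1^ toℕ i * ((X (inject₁ i) zero - b) * D (inject₁ i))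
        ≡⟨ ≡.cong (λ e → -1^ e * ((X (inject₁ i) zero - b) * D (inject₁ i))) (≡.sym (toℕ-inject₁ i)) ⟩
      -1^ toℕ (inject₁ i) * ((X (inject₁ i) zero - b) * D (inject₁ i))
        ≈⟨ x[[y-z]w]≈x[yw]-z[xw] _ _ _ _ ⟩
      init u i - b * init t i ∎

open import Data.Nat using (_+_; _%_)

lemma4p4 : ∀ {c ℓ} (F : Field c ℓ) (n k : ℕ) →
    1 ≤ k → k ≤ suc n → (suc n + k) % 2 ≡ 1 →
    (X : Mat (Field.Carrier F) (suc n) k) →
    Field._≈_ F (detCullis F (suc n) k X) (detCullis F n k (Lminus F X))
lemma4p4 F n k _ _ n+k-odd X = begin
  detCullis F (suc n) k X        ≈⟨ detCullis≈laplaceDet F (suc n) k X ⟩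
  laplaceDet F (suc n) k X       ≈⟨ laplaceDet-Lminus F n k n+k-even X ⟨
  laplaceDet F n k (Lminus F X)  ≈⟨ detCullis≈laplaceDet F n k (Lminus F X) ⟨
  detCullis F n k (Lminus F X)   ∎
  where
  open import Relation.Binary.Reasoning.Setoid (Field.setoid F)
  n+k-even : parity (n + k) ≡ 0ℙ
  n+k-even = ≡.trans (≡.sym (suc-homo-⁻¹ (n + k))) (≡.cong _⁻¹ (%2≡1⇒parity≡1ℙ (suc n + k) n+k-odd))
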